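{- Let $i$ be a non-source vertex of $G$ with predecessors $i'$ and $i''$, let $1\le j\le m$, and let $F=\{\overline{r}_{j_1},\dots,\overline{r}_{j_\ell}\}$ be a set of negated $r$-literals with $\overline{r}_j\notin F$. There is a regular tree-like resolution derivation of the clause $F\lor\overline{p}_{i,j}\lor r_j$ from clauses of $\mathrm{Stone}(G,m)$ and the clauses $\overline{p}_{i',j'}\lor r_{j'}$ and $\overline{p}_{i'',j''}\lor r_{j''}$ ($1\le j',j''\le m$), which has size $O(m^2)$ and uses as resolution variables only the variables $r_k$ for $k\notin\{j,j_1,\dots,j_\ell\}$ and the variables $p_{i',k}$, $p_{i'',k}$ for all $1\le k\le m$.
   Context: Let $G=(V,E)$ be a dag with vertices $V=\{1,\dots,N\}$, single sink $1$, every non-source vertex of in-degree $2$, edges going from larger to smaller numbers, and sources exactly $n+1,\dots,N$; let $m\ge N$. $\mathrm{Stone}(G,m)$ is the clause set over variables $p_{i,j}$ ($i\in V$, $1\le j\le m$) and $r_j$ consisting of: $\bigvee_{j=1}^m p_{i,j}$ for each vertex $i$; $\overline{p}_{i,j}\lor r_j$ for each source $i$ and each $j$; $\overline{p}_{1,j}\lor\overline{r}_j$ for each $j$; and $\overline{p}_{i',j'}\lor\overline{r}_{j'}\lor\overline{p}_{i'',j''}\lor\overline{r}_{j''}\lor\overline{p}_{i,j}\lor r_j$ whenever $i',i''$ are the two predecessors of $i$ and $j\notin\{j',j''\}$. A resolution derivation is regular if no variable is used as resolution variable twice along any path; tree-like if its underlying dag is a tree; size is number of clauses; the constant in $O$ is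 absolute. -}

module Defs where

open import Data.Nat using (ℕ; zero; suc; _+_; _*_; _≤_; _<_)
open import Data.List using (List; []; _∷_; map; _++_; upTo)
open import Data.List.Membership.Propositional using (_∈_; _∉_)
open import Data.Product using (Σ; ∃; _×_; _,_)
open import Data.Sum using (_⊎_)
open import Data.Unit using (⊤)
open import Relation.Binary.PropositionalEquality using (_≡_; _≢_)
open import Function.Bundles using (_⇔_)

-- Vertices are 1..N.  Non-sources are exactly 1..n, sources n+1..N.
-- Every non-source vertex i has exactly two (distinct) predecessors
-- pred₁ i, pred₂ i, with edges pred₁ i → i, pred₂ i → i going from
-- larger to smaller numbers (so the graph is acyclic).  Vertex 1 is the
-- unique sink: every other vertex has an outgoing edge.

record Graph : Set where
  field
    N n      : ℕ
    n≤N      : n ≤ N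
    pred₁    : ℕ → ℕ
    pred₂    : ℕ → ℕ
    pred₁-ok : ∀ i → 1 ≤ i → i ≤ n → i < pred₁ i × pred₁ i ≤ N
    pred₂-ok : ∀ i → 1 ≤ i → i ≤ n → i < pred₂ i × pred₂ i ≤ N
    pred-distinct : ∀ i → 1 ≤ i → i ≤ n → pred₁ i ≢ pred₂ i
    single-sink : ∀ v → 2 ≤ v → v ≤ N →
      ∃ λ i → 1 ≤ i × i ≤ n × (v ≡ pred₁ i ⊎ v ≡ pred₂ i)

open Graph public

data Var : Set where
  p : ℕ → ℕ → Var
  r : ℕ → Var

data Lit : Set where
  pos : Var → Lit
  neg : Var → Lit

-- A clause is a finite set of literals, represented by a list
-- (only membership matters).
Clause : Set
Clause = List Lit

_⊆_ : Clause → Clause → Set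
C ⊆ D = ∀ {l} → l ∈ C → l ∈ D

range : ℕ → List ℕ
range m = map suc (upTo m)

InRange : ℕ → ℕ → Set
InRange m k = 1 ≤ k × k ≤ m

data Stone (G : Graph) (m : ℕ) : Clause → Set where
  vertex : ∀ i → 1 ≤ i → i ≤ N G →
    Stone G m (map (λ j → pos (p i j)) (range m))
  source : ∀ i j → n G < i → i ≤ N G → InRange m j →
    Stone G m (neg (p i j) ∷ pos (r j) ∷ [])
  sink : ∀ j → InRange m j →
    Stone G m (neg (p 1 j) ∷ neg (r j) ∷ [])
  inner : ∀ i j′ j″ j → 1 ≤ i → i ≤ n G →
    InRange m j′ → InRange m j″ → InRange m j → j ≢ j′ → j ≢ j″ →
    Stone G m (neg (p (pred₁ G i) j′) ∷ neg (r j′) ∷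
               neg (p (pred₂ G i) j″) ∷ neg (r j″) ∷
               neg (p i j) ∷ pos (r j) ∷ [])

data Axioms (G : Graph) (m i : ℕ) : Clause → Set where
  stone : ∀ {C} → Stone G m C → Axioms G m i C
  pre₁  : ∀ j′ → InRange m j′ →
    Axioms G m i (neg (p (pred₁ G i) j′) ∷ pos (r j′) ∷ [])
  pre₂  : ∀ j″ → InRange m j″ →
    Axioms G m i (neg (p (pred₂ G i) j″) ∷ pos (r j″) ∷ [])

-- Tree-like resolution derivations (a tree datatype, so tree-like by
-- construction).  The resolvent of A ∋ x and B ∋ x̄ on x is the set
-- (A ∖ {x}) ∪ (B ∖ {x̄}).

data Deriv (Ax : Clause → Set) : Clause → Set where
  axiom : ∀ {C} → Ax C → Deriv Ax C
  res   : ∀ {A B} (x : Var) → Deriv Ax A → Deriv Ax B →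
          pos x ∈ A → neg x ∈ B →
          (C : Clause) →
          (∀ l → (l ∈ C) ⇔ ((l ∈ A × l ≢ pos x) ⊎ (l ∈ B × l ≢ neg x))) →
          Deriv Ax C

size : ∀ {Ax C} → Deriv Ax C → ℕ
size (axiom _) = 1
size (res _ d₁ d₂ _ _ _ _) = suc (size d₁ + size d₂)

-- regularity: no variable is resolved on twice along any path;
-- `used` is the list of variables resolved on above the current node.
RegularFrom : ∀ {Ax C} → List Var → Deriv Ax C → Set
RegularFrom used (axiom _) = ⊤
RegularFrom used (res x d₁ d₂ _ _ _ _) =
  x ∉ used × RegularFrom (x ∷ used) d₁ × RegularFrom (x ∷ used) d₂

Regular : ∀ {Ax C} → Deriv Ax C → Set
Regular = RegularFrom []

ResVarsIn : ∀ {Ax C} → (Var → Set) → Deriv Ax C → Set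
ResVarsIn P (axiom _) = ⊤
ResVarsIn P (res x d₁ d₂ _ _ _ _) = P x × ResVarsIn P d₁ × ResVarsIn P d₂

target : ℕ → ℕ → List ℕ → Clause
target i j js = map (λ k → neg (r k)) js ++ (neg (p i j) ∷ pos (r j) ∷ [])

Allowed : Graph → ℕ → ℕ → List ℕ → Var → Set
Allowed G i j js (r k)   = k ∉ (j ∷ js)
Allowed G i j js (p v k) = v ≡ pred₁ G i ⊎ v ≡ pred₂ G i

-- For each pair of colours a, b, the Stone clause of i for (a, b, j), resolved on r_a and
-- r_b against the premises for i′ and i″, is a subclause of F ∨ p̄_{i′,a} ∨ p̄_{i″,b} ∨
-- p̄_{i,j} ∨ r_j; r_k is left alone when r̄_k already lies in F, and when a or b is j a
-- premise is itself such a subclause. Resolving m of these against ⋁_b p_{i″,b} removes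
-- the p_{i″,·}, and resolving m of the results against ⋁_a p_{i′,a} removes the p_{i′,·}:
-- a tree of size O(m²). Since only subclauses are derived, a step whose pivot has already
-- disappeared is skipped. No variable resolved at a node is resolved below it, which
-- makes the tree regular.
module Submission where

open import Defs
open import Data.Empty using (⊥; ⊥-elim)
open import Data.List using (List; []; _∷_; map; _++_; filter)
open import Data.List.Membership.Propositional using (_∈_; _∉_)
open import Data.List.Membership.Propositional.Properties
  using (∈-map⁺; ∈-map⁻; ∈-++⁺ˡ; ∈-++⁺ʳ; ∈-++⁻; ∈-filter⁺; ∈-filter⁻; ∈-upTo⁻)
open import Data.List.Relation.Unary.All as All using (All; []; _∷_)
open import Data.List.Relation.Unary.Any using (here; there)
open import Data.Nat using (ℕ; zero; suc; _+_; _*_; _≤_; _<_; z≤n; s≤s; _≟_)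
open import Data.Nat.Properties
open import Data.Nat.Tactic.RingSolver using (solve-∀)
open import Data.Product using (Σ; ∃; _×_; _,_; proj₂; uncurry)
open import Data.Sum using (_⊎_; inj₁; inj₂; [_,_])
import Data.Sum as Sum
open import Data.Unit using (⊤; tt)
open import Function using (_∘_; id)
open import Function.Bundles using (_⇔_; mk⇔; Equivalence)
open import Level using (0ℓ)
open import Relation.Binary.Definitions using (DecidableEquality)
open import Relation.Binary.PropositionalEquality
  using (_≡_; _≢_; refl; sym; cong; ≢-sym)
open import Relation.Nullary using (¬_; yes; no; ¬?)
open import Relation.Unary using (Pred; _∪_; _∩_; ∁; ｛_｝; ∅)
  renaming (_⊆_ to _⊆ₚ_)
import Data.List.Membership.DecPropositional as DecMembership

_≟ᵥ_ : DecidableEquality Var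
p a b ≟ᵥ p c d with a ≟ c | b ≟ d
... | yes refl | yes refl = yes refl
... | no a≢c   | _        = no λ { refl → a≢c refl }
... | _        | no b≢d   = no λ { refl → b≢d refl }
p _ _ ≟ᵥ r _ = no λ ()
r _ ≟ᵥ p _ _ = no λ ()
r a ≟ᵥ r b with a ≟ b
... | yes refl = yes refl
... | no a≢b   = no λ { refl → a≢b refl }

_≟ₗ_ : DecidableEquality Lit
pos x ≟ₗ pos y with x ≟ᵥ y
... | yes refl = yes refl
... | no x≢y   = no λ { refl → x≢y refl }
neg x ≟ₗ neg y with x ≟ᵥ y
... | yes refl = yes refl
... | no x≢y   = no λ { refl → x≢y refl }
pos _ ≟ₗ neg _ = no λ ()
neg _ ≟ₗ pos _ = no λ ()

open DecMembership _≟ₗ_ using () renaming (_∈?_ to _∈ₗ?_)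
open DecMembership _≟_ using () renaming (_∈?_ to _∈ₙ?_)

p-injectiveˡ : ∀ {a b c d} → p a b ≡ p c d → a ≡ c
p-injectiveˡ refl = refl

drop-｛｝ : ∀ {A : Set} {S : Pred A 0ℓ} {x y} → (｛ x ｝ ∪ S) y → x ≢ y → S y
drop-｛｝ (inj₁ x≡y) x≢y = ⊥-elim (x≢y x≡y)
drop-｛｝ (inj₂ s)   _   = s

resolvent : Var → Clause → Clause → Clause
resolvent x A B = filter (λ l → ¬? (l ≟ₗ pos x)) A ++ filter (λ l → ¬? (l ≟ₗ neg x)) B

∈-resolvent⇔ : ∀ x A B l →
  (l ∈ resolvent x A B) ⇔ ((l ∈ A × l ≢ pos x) ⊎ (l ∈ B × l ≢ neg x))
∈-resolvent⇔ x A B l = mk⇔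
  (Sum.map (∈-filter⁻ _) (∈-filter⁻ _) ∘ ∈-++⁻ _)
  [ ∈-++⁺ˡ ∘ uncurry (∈-filter⁺ _) , ∈-++⁺ʳ _ ∘ uncurry (∈-filter⁺ _) ]

module _ {Ax : Clause → Set} where

  ResVarsIn-mono : ∀ {P Q : Pred Var 0ℓ} {C} (d : Deriv Ax C) →
                   P ⊆ₚ Q → ResVarsIn P d → ResVarsIn Q d
  ResVarsIn-mono (axiom _)             _   _                = tt
  ResVarsIn-mono (res _ d₁ d₂ _ _ _ _) P⊆Q (Px , P₁ , P₂) =
    P⊆Q Px , ResVarsIn-mono d₁ P⊆Q P₁ , ResVarsIn-mono d₂ P⊆Q P₂

  ResVarsIn-∩ : ∀ {P Q : Pred Var 0ℓ} {C} (d : Deriv Ax C) →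
                ResVarsIn P d → ResVarsIn Q d → ResVarsIn (P ∩ Q) d
  ResVarsIn-∩ (axiom _)             _                _                = tt
  ResVarsIn-∩ (res _ d₁ d₂ _ _ _ _) (Px , P₁ , P₂) (Qx , Q₁ , Q₂) =
    (Px , Qx) , ResVarsIn-∩ d₁ P₁ Q₁ , ResVarsIn-∩ d₂ P₂ Q₂

  ResVarsIn-universal : ∀ {P : Pred Var 0ℓ} {C} (d : Deriv Ax C) →
                        (∀ y → P y) → ResVarsIn P d
  ResVarsIn-universal (axiom _)             _ = tt
  ResVarsIn-universal (res x d₁ d₂ _ _ _ _) P =
    P x , ResVarsIn-universal d₁ P , ResVarsIn-universal d₂ P

  StronglyRegular : ∀ {C} → Deriv Ax C → Set
  StronglyRegular (axiom _) = ⊤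
  StronglyRegular (res x d₁ d₂ _ _ _ _) =
    ResVarsIn (∁ ｛ x ｝) d₁ × ResVarsIn (∁ ｛ x ｝) d₂ ×
    StronglyRegular d₁ × StronglyRegular d₂

  stronglyRegular⇒regularFrom : ∀ {C} (d : Deriv Ax C) used → StronglyRegular d →
                                ResVarsIn (_∉ used) d → RegularFrom used d
  stronglyRegular⇒regularFrom (axiom _) _ _ _ = tt
  stronglyRegular⇒regularFrom (res x d₁ d₂ _ _ _ _) used
                              (fresh₁ , fresh₂ , sr₁ , sr₂) (x∉used , unused₁ , unused₂) =
    x∉used , below d₁ sr₁ fresh₁ unused₁ , below d₂ sr₂ fresh₂ unused₂
    where
    ∉-∷ : ∀ {y} → (∁ ｛ x ｝ ∩ (_∉ used)) y → y ∉ x ∷ used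
    ∉-∷ (x≢y , _)      (here y≡x)     = x≢y (sym y≡x)
    ∉-∷ (_   , y∉used) (there y∈used) = y∉used y∈used
    below : ∀ {C} (d : Deriv Ax C) → StronglyRegular d →
            ResVarsIn (∁ ｛ x ｝) d → ResVarsIn (_∉ used) d → RegularFrom (x ∷ used) d
    below d sr fresh unused =
      stronglyRegular⇒regularFrom d (x ∷ used) sr (ResVarsIn-mono d ∉-∷ (ResVarsIn-∩ d fresh unused))

  stronglyRegular⇒regular : ∀ {C} (d : Deriv Ax C) → StronglyRegular d → Regular d
  stronglyRegular⇒regular d sr = stronglyRegular⇒regularFrom d [] sr (ResVarsIn-universal d λ _ ())

record Derivation (Ax : Clause → Set) (S : Pred Lit 0ℓ) (Q : Pred Var 0ℓ) (s : ℕ) : Set where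
  field
    clause           : Clause
    deriv            : Deriv Ax clause
    clause⊆          : (_∈ clause) ⊆ₚ S
    strongly-regular : StronglyRegular deriv
    resolves-in      : ResVarsIn Q deriv
    size≤            : size deriv ≤ s
open Derivation

module _ {Ax : Clause → Set} where

  fromAxiom : ∀ {S C} → Ax C → All S C → Derivation Ax S ∅ 1
  fromAxiom {C = C} ax S-C = record
    { clause = C ; deriv = axiom ax ; clause⊆ = All.lookup S-C
    ; strongly-regular = tt ; resolves-in = tt ; size≤ = ≤-refl }

  relax : ∀ {S S′ Q Q′ s s′} → S ⊆ₚ S′ → Q ⊆ₚ Q′ → s ≤ s′ →
          Derivation Ax S Q s → Derivation Ax S′ Q′ s′
  relax S⊆S′ Q⊆Q′ s≤s′ D = record
    { clause = clause D ; deriv = deriv D ; clause⊆ = S⊆S′ ∘ clause⊆ D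
    ; strongly-regular = strongly-regular D
    ; resolves-in = ResVarsIn-mono (deriv D) Q⊆Q′ (resolves-in D)
    ; size≤ = ≤-trans (size≤ D) s≤s′ }

  discard-absent : ∀ {S Q s l} (D : Derivation Ax (｛ l ｝ ∪ S) Q s) →
                   l ∉ clause D → Derivation Ax S Q s
  discard-absent {S} D l∉D = record
    { clause = clause D ; deriv = deriv D
    ; clause⊆ = λ l′∈D → drop-｛｝ {S = S} (clause⊆ D l′∈D) λ { refl → l∉D l′∈D }
    ; strongly-regular = strongly-regular D ; resolves-in = resolves-in D ; size≤ = size≤ D }

  resolve : ∀ {S Q sA sB} x → Derivation Ax (｛ pos x ｝ ∪ S) Q sA →
            Derivation Ax (｛ neg x ｝ ∪ S) Q sB → ¬ Q x →
            Derivation Ax S (｛ x ｝ ∪ Q) (suc (sA + sB))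
  resolve {S} {Q} {sA} {sB} x A B x∉Q with pos x ∈ₗ? clause A | neg x ∈ₗ? clause B
  ... | no pos∉A | _ =
    relax id inj₂ (≤-trans (m≤m+n sA sB) (n≤1+n _)) (discard-absent A pos∉A)
  ... | yes _ | no neg∉B =
    relax id inj₂ (≤-trans (m≤n+m sB sA) (n≤1+n _)) (discard-absent B neg∉B)
  ... | yes pos∈A | yes neg∈B = record
    { clause = resolvent x (clause A) (clause B)
    ; deriv = res x (deriv A) (deriv B) pos∈A neg∈B _ (∈-resolvent⇔ x (clause A) (clause B))
    ; clause⊆ = [ side A , side B ] ∘ Equivalence.to (∈-resolvent⇔ x (clause A) (clause B) _)
    ; strongly-regular = fresh A , fresh B , strongly-regular A , strongly-regular B
    ; resolves-in = inj₁ refl , ResVarsIn-mono (deriv A) inj₂ (resolves-in A)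
                              , ResVarsIn-mono (deriv B) inj₂ (resolves-in B)
    ; size≤ = s≤s (+-mono-≤ (size≤ A) (size≤ B)) }
    where
    side : ∀ {l₀ s l} (D : Derivation Ax (｛ l₀ ｝ ∪ S) Q s) →
           l ∈ clause D × l ≢ l₀ → S l
    side D (l∈D , l≢l₀) = drop-｛｝ {S = S} (clause⊆ D l∈D) (≢-sym l≢l₀)
    fresh : ∀ {l₀ s} (D : Derivation Ax (｛ l₀ ｝ ∪ S) Q s) → ResVarsIn (∁ ｛ x ｝) (deriv D)
    fresh D = ResVarsIn-mono (deriv D) (λ { Qy refl → x∉Q Qy }) (resolves-in D)

AtVertex : ℕ → Pred Var 0ℓ
AtVertex v y = ∃ λ k → y ≡ p v k

vertexClause : ℕ → ℕ → Clause
vertexClause v m = map (λ k → pos (p v k)) (range m)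

module _ {Ax : Clause → Set} {S : Pred Lit 0ℓ} {W : Pred Var 0ℓ} {s : ℕ} (v m : ℕ)
         (W-avoids-v : ∀ k → ¬ W (p v k)) (vertex : Ax (vertexClause v m))
         (premise : ∀ k → InRange m k → Derivation Ax (｛ neg (p v k) ｝ ∪ S) W s) where

  private
    Remaining : ℕ → Pred Lit 0ℓ
    Remaining t l = ∃ λ k → t < k × k ≤ m × l ≡ pos (p v k)

    Eliminated : ℕ → Pred Var 0ℓ
    Eliminated t y = ∃ λ k → k ≤ t × y ≡ p v k

    vertexClause-remaining : All (Remaining 0 ∪ S) (vertexClause v m)
    vertexClause-remaining = All.tabulate λ l∈ → inj₁ (remaining l∈)
      where
      remaining : ∀ {l} → l ∈ vertexClause v m → Remaining 0 l
      remaining l∈ with ∈-map⁻ _ l∈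
      ... | _ , k∈ , refl with ∈-map⁻ suc k∈
      ...   | k , k∈upTo , refl = suc k , s≤s z≤n , ∈-upTo⁻ k∈upTo , refl

    eliminate-up-to : ∀ t → t ≤ m →
                      Derivation Ax (Remaining t ∪ S) (W ∪ Eliminated t) (suc (t * suc s))
    eliminate-up-to zero    _   = relax id (λ ()) ≤-refl (fromAxiom vertex vertexClause-remaining)
    eliminate-up-to (suc t) t<m =
      relax id grow (≤-reflexive (cong (suc ∘ suc) (+-comm (t * suc s) s)))
        (resolve (p v (suc t))
          (relax split id ≤-refl (eliminate-up-to t (≤-trans (n≤1+n t) t<m)))
          (relax (Sum.map id inj₂) inj₁ ≤-refl (premise (suc t) (s≤s z≤n , t<m)))
          fresh)
      where
      split : (Remaining t ∪ S) ⊆ₚ (｛ pos (p v (suc t)) ｝ ∪ Remaining (suc t) ∪ S)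
      split (inj₁ (k , t<k , k≤m , refl)) with k ≟ suc t
      ... | yes refl = inj₁ refl
      ... | no k≢1+t = inj₂ (inj₁ (k , ≤∧≢⇒< t<k (≢-sym k≢1+t) , k≤m , refl))
      split (inj₂ s) = inj₂ (inj₂ s)
      fresh : ¬ (W ∪ Eliminated t) (p v (suc t))
      fresh (inj₁ w)              = W-avoids-v (suc t) w
      fresh (inj₂ (k , k≤t , e)) with refl ← e = 1+n≰n k≤t
      grow : (｛ p v (suc t) ｝ ∪ W ∪ Eliminated t) ⊆ₚ (W ∪ Eliminated (suc t))
      grow (inj₁ refl)                  = inj₂ (suc t , ≤-refl , refl)
      grow (inj₂ (inj₁ w))              = inj₁ w
      grow (inj₂ (inj₂ (k , k≤t , e))) = inj₂ (k , m≤n⇒m≤1+n k≤t , e)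

  eliminate-vertex : Derivation Ax S (W ∪ AtVertex v) (suc (m * suc s))
  eliminate-vertex = relax none-remaining at-vertex ≤-refl (eliminate-up-to m ≤-refl)
    where
    none-remaining : (Remaining m ∪ S) ⊆ₚ S
    none-remaining (inj₁ (_ , m<k , k≤m , _)) = ⊥-elim (<⇒≱ m<k k≤m)
    none-remaining (inj₂ s)                   = s
    at-vertex : (W ∪ Eliminated m) ⊆ₚ (W ∪ AtVertex v)
    at-vertex = Sum.map id λ { (k , _ , e) → k , e }

neg-r∈target : ∀ {i j js k} → k ∈ js → neg (r k) ∈ target i j js
neg-r∈target k∈js = ∈-++⁺ˡ (∈-map⁺ (λ k → neg (r k)) k∈js)

neg-p∈target : ∀ {i j js} → neg (p i j) ∈ target i j js
neg-p∈target {js = js} = ∈-++⁺ʳ (map (λ k → neg (r k)) js) (here refl)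

pos-r∈target : ∀ {i j js} → pos (r j) ∈ target i j js
pos-r∈target {js = js} = ∈-++⁺ʳ (map (λ k → neg (r k)) js) (there (here refl))

RVarOutside : List ℕ → Pred Var 0ℓ
RVarOutside ks (r k)   = k ∉ ks
RVarOutside ks (p _ _) = ⊥

module _ (G : Graph) (m : ℕ) {i : ℕ} (1≤i : 1 ≤ i) (i≤n : i ≤ n G)
         {j : ℕ} (j-range : InRange m j) (js : List ℕ) where

  private
    Ax = Axioms G m i
    i′ = pred₁ G i
    i″ = pred₂ G i
    T  = target i j js
    R  = RVarOutside (j ∷ js)

    discharge : ∀ {S Q s} k → k ≢ j → (_∈ T) ⊆ₚ S →
                Derivation Ax (｛ pos (r k) ｝ ∪ S) ∅ 1 → ¬ Q (r k) →
                Derivation Ax (｛ neg (r k) ｝ ∪ S) Q s →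
                Derivation Ax S ((｛ r k ｝ ∩ R) ∪ Q) (suc (suc s))
    discharge k k≢j T⊆S premise fresh D with k ∈ₙ? js
    ... | yes k∈js = relax [ (λ { refl → T⊆S (neg-r∈target k∈js) }) , id ] inj₂
                           (m≤n+m _ 2) D
    ... | no k∉js = relax id (Sum.map (λ { refl → refl , outside }) id) ≤-refl
                          (resolve (r k) (relax id (λ ()) ≤-refl premise) D fresh)
      where
      outside : k ∉ j ∷ js
      outside (here k≡j)    = k≢j k≡j
      outside (there k∈js) = k∉js k∈js

    Leaf : ℕ → ℕ → Pred Lit 0ℓ
    Leaf a b = ｛ neg (p i″ b) ｝ ∪ ｛ neg (p i′ a) ｝ ∪ (_∈ T)

    leaf : ∀ a b → InRange m a → InRange m b → Derivation Ax (Leaf a b) R 5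
    leaf a b a-range b-range with b ≟ j | a ≟ j
    ... | yes refl | _ =
      relax id (λ ()) (s≤s z≤n)
        (fromAxiom (pre₂ b b-range) (inj₁ refl ∷ inj₂ (inj₂ pos-r∈target) ∷ []))
    ... | no _ | yes refl =
      relax id (λ ()) (s≤s z≤n)
        (fromAxiom (pre₁ a a-range) (inj₂ (inj₁ refl) ∷ inj₂ (inj₂ pos-r∈target) ∷ []))
    ... | no b≢j | no a≢j with a ≟ b
    ...   | yes refl =
      -- the inner clause then contains r̄_a twice, so one resolution on r_a suffices
      relax id [ proj₂ , (λ ()) ] (s≤s (s≤s (s≤s z≤n)))
        (discharge a a≢j (inj₂ ∘ inj₂) premise₁
          (λ ()) (fromAxiom inner-clause
            (inj₂ (inj₂ (inj₁ refl)) ∷ inj₁ refl ∷ inj₂ (inj₁ refl) ∷ inj₁ refl ∷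
             inj₂ (inj₂ (inj₂ neg-p∈target)) ∷ inj₂ (inj₂ (inj₂ pos-r∈target)) ∷ [])))
      where
      inner-clause = stone (inner i a a j 1≤i i≤n a-range a-range j-range (≢-sym a≢j) (≢-sym a≢j))
      premise₁ = fromAxiom (pre₁ a a-range) (inj₂ (inj₂ (inj₁ refl)) ∷ inj₁ refl ∷ [])
    ...   | no a≢b =
      relax id [ proj₂ , [ proj₂ , (λ ()) ] ] ≤-refl
        (discharge b b≢j (inj₂ ∘ inj₂) premise₂ r-b-fresh
          (discharge a a≢j (inj₂ ∘ inj₂ ∘ inj₂) premise₁
            (λ ()) (fromAxiom inner-clause
              (inj₂ (inj₂ (inj₂ (inj₁ refl))) ∷ inj₁ refl ∷ inj₂ (inj₂ (inj₁ refl)) ∷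
               inj₂ (inj₁ refl) ∷ inj₂ (inj₂ (inj₂ (inj₂ neg-p∈target))) ∷
               inj₂ (inj₂ (inj₂ (inj₂ pos-r∈target))) ∷ []))))
      where
      inner-clause = stone (inner i a b j 1≤i i≤n a-range b-range j-range (≢-sym a≢j) (≢-sym b≢j))
      premise₁ = fromAxiom (pre₁ a a-range) (inj₂ (inj₂ (inj₂ (inj₁ refl))) ∷ inj₁ refl ∷ [])
      premise₂ = fromAxiom (pre₂ b b-range) (inj₂ (inj₁ refl) ∷ inj₁ refl ∷ [])
      r-b-fresh : ¬ ((｛ r a ｝ ∩ R) ∪ ∅) (r b)
      r-b-fresh (inj₁ (refl , _)) = a≢b refl

    predecessor-vertex : ∀ {v} → i < v × v ≤ N G → Ax (vertexClause v m)
    predecessor-vertex (i<v , v≤N) = stone (vertex _ (≤-trans 1≤i (<⇒≤ i<v)) v≤N)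

    eliminate-i″ : ∀ a → InRange m a →
                   Derivation Ax (｛ neg (p i′ a) ｝ ∪ (_∈ T)) (R ∪ AtVertex i″) (suc (m * 6))
    eliminate-i″ a a-range =
      eliminate-vertex i″ m (λ _ ()) (predecessor-vertex (pred₂-ok G i 1≤i i≤n))
        (λ b b-range → leaf a b a-range b-range)

  derive-target : Derivation (Axioms G m i) (_∈ target i j js)
                    ((R ∪ AtVertex i″) ∪ AtVertex i′) (suc (m * suc (suc (m * 6))))
  derive-target =
    eliminate-vertex i′ m avoids-i′ (predecessor-vertex (pred₁-ok G i 1≤i i≤n)) eliminate-i″
    where
    avoids-i′ : ∀ k → ¬ (R ∪ AtVertex i″) (p i′ k)
    avoids-i′ k (inj₂ (_ , e)) = pred-distinct G i 1≤i i≤n (p-injectiveˡ e)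

  derive-target-allowed : (R ∪ AtVertex i″) ∪ AtVertex i′ ⊆ₚ Allowed G i j js
  derive-target-allowed {r _} (inj₁ (inj₁ outside)) = outside
  derive-target-allowed (inj₁ (inj₂ (_ , refl)))    = inj₂ refl
  derive-target-allowed (inj₂ (_ , refl))           = inj₁ refl

quadratic-bound : ∀ m → 1 ≤ m → suc (m * suc (suc (m * 6))) ≤ 9 * (m * m)
quadratic-bound (suc k) _ = ≤-trans (m≤m+n _ (k * (3 * k + 4))) (≤-reflexive (identity k))
  where
  identity : ∀ k → suc (suc k * suc (suc (suc k * 6))) + k * (3 * k + 4) ≡ 9 * (suc k * suc k)
  identity = solve-∀

theorem2p3 : ∃ λ (c : ℕ) →
    (G : Graph) (m : ℕ) → N G ≤ m →
    (i : ℕ) → 1 ≤ i → i ≤ n G →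
    (j : ℕ) → InRange m j →
    (js : List ℕ) → All (InRange m) js → j ∉ js →
    ∃ λ (D : Clause) → Σ (Deriv (Axioms G m i) D) λ d →
    D ⊆ target i j js × Regular d × ResVarsIn (Allowed G i j js) d
    × size d ≤ c * (m * m)
theorem2p3 = 9 , λ G m _ i 1≤i i≤n j j-range@(1≤j , j≤m) js _ _ →
  let D = derive-target G m 1≤i i≤n j-range js in
  clause D , deriv D , clause⊆ D ,
  stronglyRegular⇒regular (deriv D) (strongly-regular D) ,
  ResVarsIn-mono (deriv D) (derive-target-allowed G m 1≤i i≤n j-range js) (resolves-in D) ,
  ≤-trans (size≤ D) (quadratic-bound m (≤-trans 1≤j j≤m))
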